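{- Let $n$ be even. Every $(n-2)$-regular graph on $n$ vertices has an internal bisection.
   Context: Graphs are finite and simple. For $S\subseteq V$, $d_S(v)$ is the number of neighbors of $v$ in $S$ and $d(v)$ the degree of $v$. An internal partition is a partition $V=A\dot\cup B$ with $A,B\ne\emptyset$ such that $d_A(x)\ge d(x)/2$ for all $x\in A$ and $d_B(x)\ge d(x)/2$ for all $x\in B$. An internal bisection is an internal partition with $|A|=|B|$. -}

module Defs where

open import Data.Nat using (ℕ; _+_; _*_; _≤_)
open import Data.Bool using (Bool; true; false; _∧_; not; T)
open import Data.Fin using (Fin)
open import Data.Vec.Functional using (Vector)
open import Data.Vec.Functional as VF using ()
open import Data.Product using (_×_; Σ; ∃)
open import Relation.Binary.PropositionalEquality using (_≡_)

record Graph (n : ℕ) : Set where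
  field
    adj   : Fin n → Fin n → Bool
    sym   : ∀ x y → adj x y ≡ adj y x
    irrefl : ∀ x → adj x x ≡ false
open Graph public

count : ∀ {n} → (Fin n → Bool) → ℕ
count {n} p = VF.foldr _+_ 0 (λ i → toℕ (p i))
  where
  toℕ : Bool → ℕ
  toℕ true  = 1
  toℕ false = 0

Subset : ℕ → Set
Subset n = Fin n → Bool

degIn : ∀ {n} → Graph n → Subset n → Fin n → ℕ
degIn G S v = count (λ u → adj G v u ∧ S u)

deg : ∀ {n} → Graph n → Fin n → ℕ
deg G v = count (λ u → adj G v u)

Regular : ∀ {n} → Graph n → ℕ → Set
Regular G k = ∀ v → deg G v ≡ k

complement : ∀ {n} → Subset n → Subset n
complement S v = not (S v)

-- Internal partition V = A ∪̇ B with B = V \ A, A and B nonempty,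
-- d_A(x) ≥ d(x)/2 for x ∈ A and d_B(x) ≥ d(x)/2 for x ∈ B
-- (written as d(x) ≤ 2·d_S(x) to avoid division).
IsInternalPartition : ∀ {n} → Graph n → Subset n → Set
IsInternalPartition G A =
  (∃ λ a → T (A a)) × (∃ λ b → T (not (A b))) ×
  (∀ x → T (A x) → deg G x ≤ 2 * degIn G A x) ×
  (∀ x → T (not (A x)) → deg G x ≤ 2 * degIn G (complement A) x)

IsInternalBisection : ∀ {n} → Graph n → Subset n → Set
IsInternalBisection G A =
  IsInternalPartition G A × (count A ≡ count (complement A))

-- An (n−2)-regular graph on n vertices misses, at every vertex x, exactly one
-- other vertex p(x); so x ↦ p(x) is a fixed-point-free involution and the
-- non-edges form a perfect matching. Take A to contain the smaller endpoint of
-- every non-edge. Then |A| = |B| = n/2, and a vertex of A is adjacent to every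
-- other vertex of A, because its only non-neighbour p(x) lies in B; hence
-- d_A(x) = n/2 − 1 = d(x)/2, and symmetrically in B.
module Submission where

open import Defs renaming (sym to adj-sym)
open import Data.Bool using (Bool; true; false; _∧_; not; T)
open import Data.Bool.Properties using (∧-identityʳ; ∧-zeroʳ; T-≡)
open import Data.Fin using (Fin; zero; suc; _≟_; _<?_)
open import Data.Fin.Permutation using (permutation)
open import Data.Fin.Properties using (<-cmp; <-asym)
open import Data.Nat using (ℕ; zero; suc; _+_; _*_; _∸_; _≤_; _≥_; s≤s; z≤n)
open import Data.Nat.Properties
  using (+-0-commutativeMonoid; +-commutativeSemigroup; +-cancelˡ-≡; +-cancelʳ-≡; +-suc; m∸n+n≡m; ≤-reflexive; suc-injective)
open import Data.Product using (∃; _,_; _×_; proj₁; proj₂)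
open import Function using (_∘_; Equivalence)
open import Relation.Binary using (tri<; tri≈; tri>)
open import Relation.Binary.PropositionalEquality
open import Relation.Nullary using (¬_; yes; no; does; contradiction)
open import Relation.Nullary.Decidable using (dec-true; dec-false)
open import Algebra.Properties.CommutativeSemigroup +-commutativeSemigroup using (interchange)
import Algebra.Properties.CommutativeMonoid.Sum +-0-commutativeMonoid as ℕ-Sum
open import Data.Nat.Tactic.RingSolver using (solve-∀)

open Equivalence using (to; from)

Bool→ℕ : Bool → ℕ
Bool→ℕ true  = 1
Bool→ℕ false = 0

count-suc : ∀ {n} (p : Fin (suc n) → Bool) → count p ≡ Bool→ℕ (p zero) + count (p ∘ suc)
count-suc p with p zero
... | true  = refl
... | false = refl

count-cong : ∀ {n} {p q : Fin n → Bool} → (∀ i → p i ≡ q i) → count p ≡ count q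
count-cong {zero}          p≡q = refl
count-cong {suc n} {p} {q} p≡q = begin
  count p                                ≡⟨ count-suc p ⟩
  Bool→ℕ (p zero) + count (p ∘ suc)      ≡⟨ cong₂ _+_ (cong Bool→ℕ (p≡q zero)) (count-cong (p≡q ∘ suc)) ⟩
  Bool→ℕ (q zero) + count (q ∘ suc)      ≡⟨ count-suc q ⟨
  count q                                ∎
  where open ≡-Reasoning

count+count-not≡n : ∀ {n} (p : Fin n → Bool) → count p + count (not ∘ p) ≡ n
count+count-not≡n {zero}  p = refl
count+count-not≡n {suc n} p = begin
  count p + count (not ∘ p)
    ≡⟨ cong₂ _+_ (count-suc p) (count-suc (not ∘ p)) ⟩
  (Bool→ℕ (p zero) + count (p ∘ suc)) + (Bool→ℕ (not (p zero)) + count (not ∘ p ∘ suc))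
    ≡⟨ interchange (Bool→ℕ (p zero)) (count (p ∘ suc)) (Bool→ℕ (not (p zero))) (count (not ∘ p ∘ suc)) ⟩
  (Bool→ℕ (p zero) + Bool→ℕ (not (p zero))) + (count (p ∘ suc) + count (not ∘ p ∘ suc))
    ≡⟨ cong₂ _+_ (Bool→ℕ-not (p zero)) (count+count-not≡n (p ∘ suc)) ⟩
  suc n
    ∎
  where
  open ≡-Reasoning
  Bool→ℕ-not : ∀ b → Bool→ℕ b + Bool→ℕ (not b) ≡ 1
  Bool→ℕ-not true  = refl
  Bool→ℕ-not false = refl

count≡sum : ∀ {n} (p : Fin n → Bool) → count p ≡ ℕ-Sum.sum (Bool→ℕ ∘ p)
count≡sum {zero}  p = refl
count≡sum {suc n} p = trans (count-suc p) (cong (Bool→ℕ (p zero) +_) (count≡sum (p ∘ suc)))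

count-∘-involution : ∀ {n} (p : Fin n → Bool) (f : Fin n → Fin n) → (∀ x → f (f x) ≡ x) →
  count (p ∘ f) ≡ count p
count-∘-involution p f f∘f≡id = begin
  count (p ∘ f)                 ≡⟨ count≡sum (p ∘ f) ⟩
  ℕ-Sum.sum (Bool→ℕ ∘ p ∘ f)    ≡⟨ ℕ-Sum.sum-permute (Bool→ℕ ∘ p) (permutation f f f∘f≡id f∘f≡id) ⟨
  ℕ-Sum.sum (Bool→ℕ ∘ p)        ≡⟨ count≡sum p ⟨
  count p                       ∎
  where open ≡-Reasoning

count≢0⇒∃ : ∀ {n} (p : Fin n → Bool) → ¬ count p ≡ 0 → ∃ λ i → p i ≡ true
count≢0⇒∃ {zero}  p count≢0 = contradiction refl count≢0
count≢0⇒∃ {suc n} p count≢0 with p zero in p0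
... | true  = zero , p0
-- once p zero is false, count p reduces to count (p ∘ suc)
... | false =
  let i , pi = count≢0⇒∃ (p ∘ suc) count≢0
  in suc i , pi

without : ∀ {n} → (Fin n → Bool) → Fin n → Fin n → Bool
without p i j = p j ∧ not (does (j ≟ i))

count-without : ∀ {n} (p : Fin n → Bool) (i : Fin n) → p i ≡ true →
  count p ≡ suc (count (without p i))
count-without p zero pi rewrite count-suc p | count-suc (without p zero) | pi =
  cong suc (count-cong (λ j → sym (∧-identityʳ (p (suc j)))))
count-without p (suc i) pi rewrite count-suc p | count-suc (without p (suc i))
  | ∧-identityʳ (p zero) | count-without (p ∘ suc) i pi = +-suc (Bool→ℕ (p zero)) _

count≡1⇒unique : ∀ {n} (p : Fin n → Bool) → count p ≡ 1 →
  ∀ {i j} → p i ≡ true → p j ≡ true → i ≡ j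
count≡1⇒unique p count≡1 {i} {j} pi pj with i ≟ j
... | yes i≡j = i≡j
... | no  i≢j = contradiction (trans (sym count≡1) count≡2+) λ ()
  where
  pj′ : without p i j ≡ true
  pj′ rewrite pj | dec-false (j ≟ i) (i≢j ∘ sym) = refl
  count≡2+ : count p ≡ suc (suc (count (without (without p i) j)))
  count≡2+ = trans (count-without p i pi) (cong suc (count-without (without p i) j pj′))

<?-flip : ∀ {n} {x y : Fin n} → x ≢ y → does (y <? x) ≡ not (does (x <? y))
<?-flip {x = x} {y} x≢y with <-cmp x y
... | tri< x<y _ _ rewrite dec-true (x <? y) x<y | dec-false (y <? x) (<-asym x<y) = refl
... | tri≈ _ x≡y _ = contradiction x≡y x≢y
... | tri> _ _ y<x rewrite dec-true (y <? x) y<x | dec-false (x <? y) (<-asym y<x) = refl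

coNeighbours : ∀ {n} → Graph n → Fin n → Subset n
coNeighbours G x = without (not ∘ adj G x) x

coNeighbour-intro : ∀ {n} (G : Graph n) {x u} → adj G x u ≡ false → u ≢ x → coNeighbours G x u ≡ true
coNeighbour-intro G {x} {u} nonadj u≢x rewrite nonadj | dec-false (u ≟ x) u≢x = refl

coNeighbour-elim : ∀ {n} (G : Graph n) {x u} → coNeighbours G x u ≡ true → adj G x u ≡ false × u ≢ x
coNeighbour-elim G {x} {u} co with adj G x u | u ≟ x
... | false | no u≢x = refl , u≢x
... | false | yes _  = contradiction co λ ()
... | true  | _      = contradiction co λ ()

deg+count-coNeighbours : ∀ {n} (G : Graph n) x → deg G x + suc (count (coNeighbours G x)) ≡ n
deg+count-coNeighbours {n} G x = begin
  deg G x + suc (count (coNeighbours G x))  ≡⟨ cong (deg G x +_) (count-without (not ∘ adj G x) x (cong not (irrefl G x))) ⟨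
  deg G x + count (not ∘ adj G x)           ≡⟨ count+count-not≡n (adj G x) ⟩
  n                                         ∎
  where open ≡-Reasoning

regular⇒unique-coNeighbour : ∀ {n} (G : Graph n) → Regular G (n ∸ 2) → 2 ≤ n →
  ∀ x → count (coNeighbours G x) ≡ 1
regular⇒unique-coNeighbour {n} G reg 2≤n x = suc-injective (+-cancelˡ-≡ (n ∸ 2) _ 2 (begin
  n ∸ 2 + suc (count (coNeighbours G x))    ≡⟨ cong (_+ suc (count (coNeighbours G x))) (reg x) ⟨
  deg G x + suc (count (coNeighbours G x))  ≡⟨ deg+count-coNeighbours G x ⟩
  n                                         ≡⟨ m∸n+n≡m 2≤n ⟨
  n ∸ 2 + 2                                 ∎))
  where open ≡-Reasoning

1+d+1+d≡2*d+2 : ∀ d → suc d + suc d ≡ 2 * d + 2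
1+d+1+d≡2*d+2 = solve-∀

module CoMatching {n} (G : Graph n) (unique-coNeighbour : ∀ x → count (coNeighbours G x) ≡ 1) where

  partner-spec : ∀ x → ∃ λ y → coNeighbours G x y ≡ true
  partner-spec x = count≢0⇒∃ (coNeighbours G x) λ count≡0 → contradiction (trans (sym (unique-coNeighbour x)) count≡0) λ ()

  partner : Fin n → Fin n
  partner = proj₁ ∘ partner-spec

  partner-nonadj : ∀ x → adj G x (partner x) ≡ false
  partner-nonadj x = proj₁ (coNeighbour-elim G (proj₂ (partner-spec x)))

  partner-≢ : ∀ x → partner x ≢ x
  partner-≢ x = proj₂ (coNeighbour-elim G (proj₂ (partner-spec x)))

  nonadj⇒≡partner : ∀ {x u} → adj G x u ≡ false → u ≢ x → u ≡ partner x
  nonadj⇒≡partner {x} nonadj u≢x =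
    count≡1⇒unique _ (unique-coNeighbour x) (coNeighbour-intro G nonadj u≢x) (proj₂ (partner-spec x))

  partner-involutive : ∀ x → partner (partner x) ≡ x
  partner-involutive x = sym (nonadj⇒≡partner (trans (adj-sym G (partner x) x) (partner-nonadj x)) (partner-≢ x ∘ sym))

  adj-unless-partner : ∀ {x u} → u ≢ x → u ≢ partner x → adj G x u ≡ true
  adj-unless-partner {x} {u} u≢x u≢px with adj G x u in nonadj
  ... | true  = refl
  ... | false = contradiction (nonadj⇒≡partner nonadj u≢x) u≢px

  deg+2≡n : ∀ x → deg G x + 2 ≡ n
  deg+2≡n x = trans (cong (λ k → deg G x + suc k) (sym (unique-coNeighbour x))) (deg+count-coNeighbours G x)

  Splits : Subset n → Set
  Splits S = ∀ x → S (partner x) ≡ not (S x)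

  complement-splits : ∀ {S} → Splits S → Splits (complement S)
  complement-splits splits = cong not ∘ splits

  splits⇒nonempty : ∀ {S} → Splits S → Fin n → ∃ λ a → T (S a)
  splits⇒nonempty {S} splits v with S v in Sv
  ... | true  = v , from T-≡ Sv
  ... | false = partner v , from T-≡ (trans (splits v) (cong not Sv))

  count-complement : ∀ {S} → Splits S → count (complement S) ≡ count S
  count-complement {S} splits = trans (count-cong (sym ∘ splits)) (count-∘-involution S partner partner-involutive)

  count+count≡n : ∀ {S} → Splits S → count S + count S ≡ n
  count+count≡n {S} splits = trans (cong (count S +_) (sym (count-complement splits))) (count+count-not≡n S)

  -- A vertex x ∈ S is adjacent to all of S except itself, as its partner lies outside S.
  count≡suc-degIn : ∀ {S} → Splits S → ∀ {x} → S x ≡ true → count S ≡ suc (degIn G S x)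
  count≡suc-degIn {S} splits {x} Sx = trans (count-without S x Sx) (cong suc (count-cong without≗adj∧))
    where
    without≗adj∧ : ∀ u → without S x u ≡ adj G x u ∧ S u
    without≗adj∧ u with u ≟ x
    ... | yes refl = trans (∧-zeroʳ (S x)) (cong (_∧ S x) (sym (irrefl G x)))
    ... | no u≢x with u ≟ partner x
    ...   | yes refl rewrite partner-nonadj x | splits x | Sx = refl
    ...   | no u≢px rewrite adj-unless-partner u≢x u≢px = ∧-identityʳ (S u)

  deg≡2*degIn : ∀ {S} → Splits S → ∀ {x} → S x ≡ true → deg G x ≡ 2 * degIn G S x
  deg≡2*degIn {S} splits {x} Sx = +-cancelʳ-≡ 2 (deg G x) (2 * degIn G S x) (begin
    deg G x + 2                               ≡⟨ deg+2≡n x ⟩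
    n                                         ≡⟨ count+count≡n splits ⟨
    count S + count S                         ≡⟨ cong₂ _+_ (count≡suc-degIn splits Sx) (count≡suc-degIn splits Sx) ⟩
    suc (degIn G S x) + suc (degIn G S x)     ≡⟨ 1+d+1+d≡2*d+2 (degIn G S x) ⟩
    2 * degIn G S x + 2                       ∎)
    where open ≡-Reasoning

  splits⇒internalBisection : ∀ {S} → Splits S → Fin n → IsInternalBisection G S
  splits⇒internalBisection splits v =
    ( ( splits⇒nonempty splits v
      , splits⇒nonempty (complement-splits splits) v
      , internal splits
      , internal (complement-splits splits) )
    , sym (count-complement splits) )
    where
    internal : ∀ {S} → Splits S → ∀ x → T (S x) → deg G x ≤ 2 * degIn G S x
    internal splits x Sx = ≤-reflexive (deg≡2*degIn splits (to T-≡ Sx))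

  smallerEndpoints : Subset n
  smallerEndpoints x = does (x <? partner x)

  smallerEndpoints-splits : Splits smallerEndpoints
  smallerEndpoints-splits x =
    trans (cong (does ∘ (partner x <?_)) (partner-involutive x)) (<?-flip (partner-≢ x ∘ sym))

theorem2 : (m : ℕ) → m ≥ 1 → (G : Graph (m + m)) → Regular G ((m + m) ∸ 2) →
    ∃ λ A → IsInternalBisection G A
theorem2 (suc m) _ G reg = smallerEndpoints , splits⇒internalBisection smallerEndpoints-splits zero
  where
  2≤n : 2 ≤ suc m + suc m
  2≤n = s≤s (subst (1 ≤_) (sym (+-suc m m)) (s≤s z≤n))
  open CoMatching G (regular⇒unique-coNeighbour G reg 2≤n)
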